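{- Let $\varphi$ be a $\mathrm{C}^2$ sentence in normal form and $\mathcal{G}$ a finite $\sigma$-structure with $\mathcal{G}\models\varphi$. For every pair of 1-types $\pi_1,\pi_2$ (possibly equal) that form a noisy pair with respect to $\varphi$, at least one of $\pi_1,\pi_2$ is realized by at most $2K^\varphi+1$ elements of $\mathcal{G}$.
   Context: Vocabulary $\sigma$: unary $U_1,\dots,U_n$, binary $R_1,\dots,R_m$. A $\mathrm{C}^2$ sentence in normal form is $\varphi=\forall x\,\gamma(x)\wedge\forall x\forall y\,(x\neq y\to\alpha(x,y))\wedge\bigwedge_{i=1}^{m'}\forall x\,\exists^{=k_i}y\,(R_i(x,y)\wedge x\neq y)$, with $\gamma,\alpha$ quantifier-free, $0\le m'\le m$, $k_i\in\mathbb{N}$, and $\exists^{=k}$ meaning "exactly $k$". $K^\varphi:=\sum_{i=1}^{m'}k_i$. 1-types are maximal consistent subsets of $\{U_i(x),\neg U_i(x)\}_{i\le n}\cup\{R_i(x,x),\neg R_i(x,x)\}_{i\le m}$; 2-types are maximal consistent subsets of $\{R_i(x,y),\neg R_i(x,y),R_i(y,x),\neg R_i(y,x)\}_{i\le m}$; $\bar\eta$ swaps $x$ and $y$ in $\eta$. For 1-types $\pi_1,\pi_2$, $\mathsf{TwoTps}^\varphi_{\pi_1,\pi_2}$ is the set of 2-types $\eta$ with $\pi_1(x)\wedge\eta(x,y)\wedge\pi_2(y)\models\alpha(x,y)$ and $\pi_2(x)\wedge\bar\eta(x,y)\wedge\pi_1(y)\models\alpha(x,y)$. A 2-type $\eta$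 is forward-silent if $\neg R_i(x,y)\in\eta$ for all $1\le i\le m'$, and backward-silent if $\neg R_i(y,x)\in\eta$ for all $1\le i\le m'$. $\pi_1,\pi_2$ are silent-compatible if some $\eta\in\mathsf{TwoTps}^\varphi_{\pi_1,\pi_2}$ is both forward- and backward-silent; otherwise they form a noisy pair. An element realizes $\pi$ if its 1-type is $\pi$. -}

module Defs where

open import Data.Nat using (ℕ; _≤_; _+_; _*_)
open import Data.Bool using (Bool; true; false; T; not; _∧_; _∨_)
open import Data.Fin using (Fin; inject≤; _≟_)
open import Data.Fin.Properties using () renaming (_≟_ to _≟ᶠ_)
open import Data.List using (List; length; filter; map; allFin)
open import Data.Nat.ListAction using (sum)
open import Data.Vec using (Vec; tabulate)
open import Data.Vec.Properties using () renaming (≡-dec to ≡-decᵛ)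
open import Data.Bool.Properties using () renaming (_≟_ to _≟ᵇ_)
open import Data.Product using (Σ; _×_; _,_; proj₁; proj₂)
open import Data.Product.Properties using () renaming (≡-dec to ≡-decˣ)
open import Data.Unit using (⊤; tt)
open import Relation.Binary.PropositionalEquality using (_≡_; _≢_)
open import Relation.Nullary using (¬_; does)
open import Relation.Binary.Definitions using (DecidableEquality)

-- Vocabulary σ : unary U_0..U_{n-1}  (Fin n), binary R_0..R_{m-1} (Fin m)

data QF (n m : ℕ) (V : Set) : Set where
  tru  : QF n m V
  U    : Fin n → V → QF n m V
  R    : Fin m → V → V → QF n m V
  eq   : V → V → QF n m V
  neg  : QF n m V → QF n m V
  conj : QF n m V → QF n m V → QF n m V
  disj : QF n m V → QF n m V → QF n m V

record Structure (n m : ℕ) : Set where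
  field
    size : ℕ
    Uᴳ   : Fin n → Fin size → Bool
    Rᴳ   : Fin m → Fin size → Fin size → Bool
open Structure public

Dom : ∀ {n m} → Structure n m → Set
Dom G = Fin (size G)

eval : ∀ {n m V} (G : Structure n m) → (V → Dom G) → QF n m V → Bool
eval G ρ tru        = true
eval G ρ (U i v)    = Uᴳ G i (ρ v)
eval G ρ (R i v w)  = Rᴳ G i (ρ v) (ρ w)
eval G ρ (eq v w)   = does (ρ v ≟ᶠ ρ w)
eval G ρ (neg ψ)    = not (eval G ρ ψ)
eval G ρ (conj ψ χ) = eval G ρ ψ ∧ eval G ρ χ
eval G ρ (disj ψ χ) = eval G ρ ψ ∨ eval G ρ χ

data XY : Set where
  x y : XY

⟨_,_⟩ : ∀ {A : Set} → A → A → XY → A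
⟨ a , b ⟩ x = a
⟨ a , b ⟩ y = b

-- C² sentences in normal form
--   ∀x γ(x) ∧ ∀x∀y (x≠y → α(x,y)) ∧ ⋀_{i<m'} ∀x ∃^{=k_i} y (R_i(x,y) ∧ x≠y)

record NormalForm (n m : ℕ) : Set where
  field
    γ    : QF n m ⊤
    α    : QF n m XY
    m'   : ℕ
    m'≤m : m' ≤ m
    k    : Fin m' → ℕ
open NormalForm public

cnt : ∀ {n m} (φ : NormalForm n m) → Fin (m' φ) → Fin m
cnt φ i = inject≤ i (m'≤m φ)

Kφ : ∀ {n m} → NormalForm n m → ℕ
Kφ φ = sum (map (k φ) (allFin (m' φ)))

countᴮ : ∀ {N : ℕ} → (Fin N → Bool) → ℕ
countᴮ {N} P = length (filter (λ b → T? (P b)) (allFin N))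
  where
  open import Relation.Nullary.Decidable using (Dec)
  T? : (b : Bool) → Dec (T b)
  T? = Data.Bool.T?

_⊨_ : ∀ {n m} → Structure n m → NormalForm n m → Set
G ⊨ φ =
    (∀ (a : Dom G) → T (eval G (λ _ → a) (γ φ)))
  × (∀ (a b : Dom G) → a ≢ b → T (eval G ⟨ a , b ⟩ (α φ)))
  × (∀ (i : Fin (m' φ)) (a : Dom G) →
       countᴮ (λ b → Rᴳ G (cnt φ i) a b ∧ not (does (a ≟ᶠ b))) ≡ k φ i)

-- 1-types and 2-types.
-- A 1-type (maximal consistent set of literals U_i(x)/¬U_i(x), R_i(x,x)/¬R_i(x,x))
-- is encoded by the truth values it assigns: (U-part , R(x,x)-part).
OneType : ℕ → ℕ → Set
OneType n m = Vec Bool n × Vec Bool m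

-- A 2-type (maximal consistent set of literals R_i(x,y)/¬.., R_i(y,x)/¬..)
-- encoded as (R_i(x,y)-part , R_i(y,x)-part).
TwoType : ℕ → Set
TwoType m = Vec Bool m × Vec Bool m

_≟₁_ : ∀ {n m} → DecidableEquality (OneType n m)
_≟₁_ = ≡-decˣ (≡-decᵛ _≟ᵇ_) (≡-decᵛ _≟ᵇ_)

swap : ∀ {m} → TwoType m → TwoType m
swap (f , b) = (b , f)

tp : ∀ {n m} (G : Structure n m) → Dom G → OneType n m
tp G a = tabulate (λ i → Uᴳ G i a) , tabulate (λ i → Rᴳ G i a a)

tp₂ : ∀ {n m} (G : Structure n m) → Dom G → Dom G → TwoType m
tp₂ G a b = tabulate (λ i → Rᴳ G i a b) , tabulate (λ i → Rᴳ G i b a)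

-- π₁(x) ∧ η(x,y) ∧ π₂(y) ⊨ α(x,y), where (as usual for 2-types) x and y
-- denote distinct elements: every structure with distinct a, b realising
-- π₁, η, π₂ satisfies α at (a,b).
Entails : ∀ {n m} → OneType n m → TwoType m → OneType n m → QF n m XY → Set
Entails {n} {m} π₁ η π₂ ψ =
  ∀ (G : Structure n m) (a b : Dom G) → a ≢ b →
    tp G a ≡ π₁ → tp₂ G a b ≡ η → tp G b ≡ π₂ →
    T (eval G ⟨ a , b ⟩ ψ)

InTwoTps : ∀ {n m} → NormalForm n m → OneType n m → OneType n m → TwoType m → Set
InTwoTps φ π₁ π₂ η = Entails π₁ η π₂ (α φ) × Entails π₂ (swap η) π₁ (α φ)

ForwardSilent : ∀ {n m} → NormalForm n m → TwoType m → Set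
ForwardSilent φ η = ∀ (i : Fin (m' φ)) → Data.Vec.lookup (proj₁ η) (cnt φ i) ≡ false

BackwardSilent : ∀ {n m} → NormalForm n m → TwoType m → Set
BackwardSilent φ η = ∀ (i : Fin (m' φ)) → Data.Vec.lookup (proj₂ η) (cnt φ i) ≡ false

SilentCompatible : ∀ {n m} → NormalForm n m → OneType n m → OneType n m → Set
SilentCompatible {m = m} φ π₁ π₂ =
  Σ (TwoType m) λ η → InTwoTps φ π₁ π₂ η × ForwardSilent φ η × BackwardSilent φ η

NoisyPair : ∀ {n m} → NormalForm n m → OneType n m → OneType n m → Set
NoisyPair φ π₁ π₂ = ¬ SilentCompatible φ π₁ π₂

#realise : ∀ {n m} (G : Structure n m) → OneType n m → ℕ
#realise G π = countᴮ (λ a → does (tp G a ≟₁ π))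

{-# OPTIONS --safe #-}
-- Let p and q be the numbers of elements realising π₁ and π₂. In a model of φ the
-- 2-type of any pair of distinct elements lies in TwoTps, so for a noisy pair every
-- such pair (a , b), a realising π₁ and b realising π₂, is joined by a counted
-- relation R_i (i < m') in at least one direction. Every element has exactly K
-- counted out-edges, so the at least p (q − 1) such ordered pairs are covered by at
-- most K p + K q edges. Hence p q ≤ K p + K q + p, which fails once p, q ≥ 2K + 2.
module Submission where

open import Defs
open import Data.Nat using (ℕ; zero; suc; _≤_; _<_; _+_; _*_; z≤n; s≤s; z<s)
open import Data.Nat.Properties
  using (+-*-semiring; +-mono-≤; +-monoˡ-≤; *-monoʳ-≤; *-comm; *-identityˡ; *-identityʳ;
         *-distribˡ-+; m+n≡0⇒m≡0; m+n≡0⇒n≡0; n≢0⇒n>0; m≤n⇒∃[o]m+o≡n; m<m+n; <⇒≱;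
         ≤-<-connex; ≤-reflexive; ≤-trans; module ≤-Reasoning)
open import Data.Nat.ListAction using () renaming (sum to sumˡ)
open import Data.Nat.Tactic.RingSolver using (solve-∀)
open import Algebra.Properties.Semiring.Sum +-*-semiring
  using (sum; sum-syntax; sum-cong-≗; ∑-distrib-+; ∑-comm; *-distribˡ-sum; *-distribʳ-sum;
         sum-replicate-zero)
open import Data.Bool using (Bool; true; false; T; T?; not; _∧_; _∨_)
open import Data.Bool.Properties using (∧-identityʳ)
open import Data.Fin using (Fin; zero; suc)
open import Data.Fin.Properties using (_≟_)
open import Data.List as List using (List; []; _∷_; length; filter; allFin)
open import Data.List.Properties using (map-tabulate)
open import Data.Product using (_,_; proj₁)
open import Data.Product.Properties using (,-injectiveˡ; ,-injectiveʳ)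
open import Data.Sum using (_⊎_; inj₁; inj₂)
open import Data.Unit using (tt)
open import Data.Vec as Vec using (lookup)
open import Data.Vec.Properties using (lookup∘tabulate)
open import Function using (_∘_; id; const; flip; _⇔_; mk⇔)
open import Relation.Binary.PropositionalEquality
  using (_≡_; _≢_; refl; sym; trans; cong; cong₂; subst; subst₂; module ≡-Reasoning)
open import Relation.Nullary using (Dec; does; yes; no; contradiction)
open import Relation.Nullary.Decidable using (dec-false; does-⇔)

𝟙 : Bool → ℕ
𝟙 true  = 1
𝟙 false = 0

𝟙≡0⇒false : ∀ {c} → 𝟙 c ≡ 0 → c ≡ false
𝟙≡0⇒false {false} _ = refl

T-does⇒ : ∀ {P : Set} (P? : Dec P) → T (does P?) → P
T-does⇒ (yes p) _  = p
T-does⇒ (no _)  ()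

[_≢_] : ∀ {N} → Fin N → Fin N → ℕ
[ a ≢ b ] = 𝟙 (not (does (a ≟ b)))

∑-mono-≤ : ∀ {N} {f g : Fin N → ℕ} → (∀ i → f i ≤ g i) → sum f ≤ sum g
∑-mono-≤ {zero}  f≤g = z≤n
∑-mono-≤ {suc N} f≤g = +-mono-≤ (f≤g zero) (∑-mono-≤ (f≤g ∘ suc))

∑≡0⇒≡0 : ∀ {N} (f : Fin N → ℕ) → sum f ≡ 0 → ∀ i → f i ≡ 0
∑≡0⇒≡0 f ∑f≡0 zero    = m+n≡0⇒m≡0 (f zero) ∑f≡0
∑≡0⇒≡0 f ∑f≡0 (suc i) = ∑≡0⇒≡0 (f ∘ suc) (m+n≡0⇒n≡0 (f zero) ∑f≡0) i

∑-𝟙-≟ : ∀ {N} (a : Fin N) → ∑[ b < N ] 𝟙 (does (a ≟ b)) ≡ 1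
∑-𝟙-≟ {suc N} zero    = cong suc (sum-replicate-zero N)
∑-𝟙-≟ {suc N} (suc a) = ∑-𝟙-≟ a

∑𝟙≤∑𝟙-off-diagonal+1 : ∀ {N} (B : Fin N → Bool) (a : Fin N) →
  ∑[ b < N ] 𝟙 (B b) ≤ ∑[ b < N ] (𝟙 (B b) * [ a ≢ b ]) + 1
∑𝟙≤∑𝟙-off-diagonal+1 {N} B a = begin
    ∑[ b < N ] 𝟙 (B b)
  ≤⟨ ∑-mono-≤ (λ b → split (B b) (does (a ≟ b))) ⟩
    ∑[ b < N ] (𝟙 (B b) * [ a ≢ b ] + 𝟙 (does (a ≟ b)))
  ≡⟨ ∑-distrib-+ (λ b → 𝟙 (B b) * [ a ≢ b ]) (λ b → 𝟙 (does (a ≟ b))) ⟩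
    ∑[ b < N ] (𝟙 (B b) * [ a ≢ b ]) + ∑[ b < N ] 𝟙 (does (a ≟ b))
  ≡⟨ cong (∑[ b < N ] (𝟙 (B b) * [ a ≢ b ]) +_) (∑-𝟙-≟ a) ⟩
    ∑[ b < N ] (𝟙 (B b) * [ a ≢ b ]) + 1 ∎
  where
  open ≤-Reasoning
  split : ∀ c d → 𝟙 c ≤ 𝟙 c * 𝟙 (not d) + 𝟙 d
  split false d     = z≤n
  split true  false = s≤s z≤n
  split true  true  = s≤s z≤n

∑∑-weighted-≤ : ∀ {N M K} (w : Fin N → ℕ) (E : Fin N → Fin M → ℕ) →
  (∀ a → ∑[ b < M ] E a b ≤ K) → ∑[ a < N ] ∑[ b < M ] (w a * E a b) ≤ K * ∑[ a < N ] w a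
∑∑-weighted-≤ {N} {M} {K} w E out-≤ = begin
    ∑[ a < N ] ∑[ b < M ] (w a * E a b)
  ≡⟨ sum-cong-≗ (λ a → *-distribˡ-sum (w a) (E a)) ⟨
    ∑[ a < N ] (w a * ∑[ b < M ] E a b)
  ≤⟨ ∑-mono-≤ (λ a → *-monoʳ-≤ (w a) (out-≤ a)) ⟩
    ∑[ a < N ] (w a * K)
  ≡⟨ *-distribʳ-sum K w ⟨
    sum w * K
  ≡⟨ *-comm (sum w) K ⟩
    K * sum w ∎
  where open ≤-Reasoning

sumˡ-tabulate : ∀ {N} (f : Fin N → ℕ) → sumˡ (List.tabulate f) ≡ sum f
sumˡ-tabulate {zero}  f = refl
sumˡ-tabulate {suc N} f = cong (f zero +_) (sumˡ-tabulate (f ∘ suc))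

sumˡ-map-allFin : ∀ {N} (f : Fin N → ℕ) → sumˡ (List.map f (allFin N)) ≡ sum f
sumˡ-map-allFin f = trans (cong sumˡ (map-tabulate id f)) (sumˡ-tabulate f)

length-filter≡sumˡ-𝟙 : ∀ {A : Set} (P : A → Bool) (xs : List A) →
  length (filter (T? ∘ P) xs) ≡ sumˡ (List.map (𝟙 ∘ P) xs)
length-filter≡sumˡ-𝟙 P []       = refl
length-filter≡sumˡ-𝟙 P (c ∷ cs) with P c
... | true  = cong suc (length-filter≡sumˡ-𝟙 P cs)
... | false = length-filter≡sumˡ-𝟙 P cs

countᴮ≡∑𝟙 : ∀ {N} (P : Fin N → Bool) → countᴮ P ≡ ∑[ a < N ] 𝟙 (P a)
countᴮ≡∑𝟙 {N} P = trans (length-filter≡sumˡ-𝟙 P (allFin N)) (sumˡ-map-allFin (𝟙 ∘ P))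

module _ {N K : ℕ} (A B : Fin N → Bool) (E : Fin N → Fin N → ℕ)
  (out-degree-≤ : ∀ a → ∑[ b < N ] E a b ≤ K)
  (covered : ∀ a b → a ≢ b → T (A a) → T (B b) → 1 ≤ E a b + E b a) where

  covering-bound : let p = ∑[ a < N ] 𝟙 (A a); q = ∑[ b < N ] 𝟙 (B b) in
    p * q ≤ K * p + K * q + p
  covering-bound = ≤-trans lower (+-monoˡ-≤ p upper)
    where
    open ≤-Reasoning
    p q pairs : ℕ
    p = ∑[ a < N ] 𝟙 (A a)
    q = ∑[ b < N ] 𝟙 (B b)
    pairs = ∑[ a < N ] ∑[ b < N ] (𝟙 (A a) * (𝟙 (B b) * [ a ≢ b ]))

    pair-covered : ∀ a b → 𝟙 (A a) * (𝟙 (B b) * [ a ≢ b ]) ≤ 𝟙 (A a) * E a b + 𝟙 (B b) * E b a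
    pair-covered a b with A a in Aa | B b in Bb | a ≟ b
    ... | false | _     | _       = z≤n
    ... | true  | false | _       = z≤n
    ... | true  | true  | yes _   = z≤n
    ... | true  | true  | no  a≢b =
      subst (1 ≤_) (sym (cong₂ _+_ (*-identityˡ (E a b)) (*-identityˡ (E b a))))
        (covered a b a≢b (subst T (sym Aa) tt) (subst T (sym Bb) tt))

    upper : pairs ≤ K * p + K * q
    upper = begin
        pairs
      ≤⟨ ∑-mono-≤ (λ a → ∑-mono-≤ (pair-covered a)) ⟩
        ∑[ a < N ] ∑[ b < N ] (𝟙 (A a) * E a b + 𝟙 (B b) * E b a)
      ≡⟨ sum-cong-≗ (λ a → ∑-distrib-+ (λ b → 𝟙 (A a) * E a b) (λ b → 𝟙 (B b) * E b a)) ⟩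
        ∑[ a < N ] (∑[ b < N ] (𝟙 (A a) * E a b) + ∑[ b < N ] (𝟙 (B b) * E b a))
      ≡⟨ ∑-distrib-+ (λ a → ∑[ b < N ] (𝟙 (A a) * E a b))
                     (λ a → ∑[ b < N ] (𝟙 (B b) * E b a)) ⟩
        ∑[ a < N ] ∑[ b < N ] (𝟙 (A a) * E a b) + ∑[ a < N ] ∑[ b < N ] (𝟙 (B b) * E b a)
      ≡⟨ cong (∑[ a < N ] ∑[ b < N ] (𝟙 (A a) * E a b) +_)
              (∑-comm (λ a b → 𝟙 (B b) * E b a)) ⟩
        ∑[ a < N ] ∑[ b < N ] (𝟙 (A a) * E a b) + ∑[ b < N ] ∑[ a < N ] (𝟙 (B b) * E b a)
      ≤⟨ +-mono-≤ (∑∑-weighted-≤ (𝟙 ∘ A) E out-degree-≤)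
                  (∑∑-weighted-≤ (𝟙 ∘ B) E out-degree-≤) ⟩
        K * p + K * q ∎

    lower : p * q ≤ pairs + p
    lower = begin
        p * q
      ≡⟨ *-distribʳ-sum q (𝟙 ∘ A) ⟩
        ∑[ a < N ] (𝟙 (A a) * q)
      ≤⟨ ∑-mono-≤ (λ a → *-monoʳ-≤ (𝟙 (A a)) (∑𝟙≤∑𝟙-off-diagonal+1 B a)) ⟩
        ∑[ a < N ] (𝟙 (A a) * (∑[ b < N ] (𝟙 (B b) * [ a ≢ b ]) + 1))
      ≡⟨ sum-cong-≗ (λ a → *-distribˡ-+ (𝟙 (A a)) _ 1) ⟩
        ∑[ a < N ] (𝟙 (A a) * ∑[ b < N ] (𝟙 (B b) * [ a ≢ b ]) + 𝟙 (A a) * 1)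
      ≡⟨ ∑-distrib-+ (λ a → 𝟙 (A a) * ∑[ b < N ] (𝟙 (B b) * [ a ≢ b ]))
                     (λ a → 𝟙 (A a) * 1) ⟩
        ∑[ a < N ] (𝟙 (A a) * ∑[ b < N ] (𝟙 (B b) * [ a ≢ b ])) + ∑[ a < N ] (𝟙 (A a) * 1)
      ≡⟨ cong₂ _+_ (sum-cong-≗ (λ a → *-distribˡ-sum (𝟙 (A a)) (λ b → 𝟙 (B b) * [ a ≢ b ])))
                   (sum-cong-≗ (λ a → *-identityʳ (𝟙 (A a)))) ⟩
        pairs + p ∎

K*p+K*q+p<p*q : ∀ K {p q} → 2 * K + 1 < p → 2 * K + 1 < q → K * p + K * q + p < p * q
K*p+K*q+p<p*q K 2K+1<p 2K+1<q
  with s , refl ← m≤n⇒∃[o]m+o≡n 2K+1<p | t , refl ← m≤n⇒∃[o]m+o≡n 2K+1<q =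
  subst (K * p + K * q + p <_) (sym (expand K s t)) (m<m+n (K * p + K * q + p) z<s)
  where
  p q : ℕ
  p = suc (2 * K + 1 + s)
  q = suc (2 * K + 1 + t)
  expand : ∀ K s t →
    suc (2 * K + 1 + s) * suc (2 * K + 1 + t)
      ≡ K * suc (2 * K + 1 + s) + K * suc (2 * K + 1 + t) + suc (2 * K + 1 + s)
        + suc (2 * K + 1 + (K + 1) * s + (K + 2) * t + s * t)
  expand = solve-∀

bounded-product⇒small-factor : ∀ K p q → p * q ≤ K * p + K * q + p → p ≤ 2 * K + 1 ⊎ q ≤ 2 * K + 1
bounded-product⇒small-factor K p q pq≤ with ≤-<-connex p (2 * K + 1) | ≤-<-connex q (2 * K + 1)
... | inj₁ p≤ | _       = inj₁ p≤
... | inj₂ _  | inj₁ q≤ = inj₂ q≤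
... | inj₂ p> | inj₂ q> = contradiction pq≤ (<⇒≱ (K*p+K*q+p<p*q K p> q>))

tabulate-injective : ∀ {A : Set} {N} {f g : Fin N → A} →
  Vec.tabulate f ≡ Vec.tabulate g → ∀ i → f i ≡ g i
tabulate-injective {f = f} {g} f≡g i =
  trans (sym (lookup∘tabulate f i)) (trans (cong (λ v → lookup v i) f≡g) (lookup∘tabulate g i))

module _ {n m} {V : Set} {G G' : Structure n m} {ρ : V → Dom G} {ρ' : V → Dom G'}
  (U-agree : ∀ i v → Uᴳ G i (ρ v) ≡ Uᴳ G' i (ρ' v))
  (R-agree : ∀ i v w → Rᴳ G i (ρ v) (ρ w) ≡ Rᴳ G' i (ρ' v) (ρ' w))
  (≟-agree : ∀ v w → does (ρ v ≟ ρ w) ≡ does (ρ' v ≟ ρ' w)) where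

  eval-cong : ∀ ψ → eval G ρ ψ ≡ eval G' ρ' ψ
  eval-cong tru        = refl
  eval-cong (U i v)    = U-agree i v
  eval-cong (R i v w)  = R-agree i v w
  eval-cong (eq v w)   = ≟-agree v w
  eval-cong (neg ψ)    = cong not (eval-cong ψ)
  eval-cong (conj ψ χ) = cong₂ _∧_ (eval-cong ψ) (eval-cong χ)
  eval-cong (disj ψ χ) = cong₂ _∨_ (eval-cong ψ) (eval-cong χ)

module _ {n m} {G G' : Structure n m} {a b : Dom G} {a' b' : Dom G'}
  (a≢b : a ≢ b) (a'≢b' : a' ≢ b')
  (tp-a : tp G a ≡ tp G' a') (tp-ab : tp₂ G a b ≡ tp₂ G' a' b') (tp-b : tp G b ≡ tp G' b') where

  eval-≡-by-types : ∀ ψ → eval G ⟨ a , b ⟩ ψ ≡ eval G' ⟨ a' , b' ⟩ ψ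
  eval-≡-by-types = eval-cong U-agree R-agree ≟-agree
    where
    ρ : XY → Dom G
    ρ = ⟨ a , b ⟩
    ρ' : XY → Dom G'
    ρ' = ⟨ a' , b' ⟩

    U-agree : ∀ i v → Uᴳ G i (ρ v) ≡ Uᴳ G' i (ρ' v)
    U-agree i x = tabulate-injective (,-injectiveˡ tp-a) i
    U-agree i y = tabulate-injective (,-injectiveˡ tp-b) i

    R-agree : ∀ i v w → Rᴳ G i (ρ v) (ρ w) ≡ Rᴳ G' i (ρ' v) (ρ' w)
    R-agree i x x = tabulate-injective (,-injectiveʳ tp-a) i
    R-agree i x y = tabulate-injective (,-injectiveˡ tp-ab) i
    R-agree i y x = tabulate-injective (,-injectiveʳ tp-ab) i
    R-agree i y y = tabulate-injective (,-injectiveʳ tp-b) i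

    same-equalities : ∀ v w → (ρ v ≡ ρ w) ⇔ (ρ' v ≡ ρ' w)
    same-equalities x x = mk⇔ (const refl) (const refl)
    same-equalities x y = mk⇔ (flip contradiction a≢b) (flip contradiction a'≢b')
    same-equalities y x = mk⇔ (flip contradiction (a≢b ∘ sym)) (flip contradiction (a'≢b' ∘ sym))
    same-equalities y y = mk⇔ (const refl) (const refl)

    ≟-agree : ∀ v w → does (ρ v ≟ ρ w) ≡ does (ρ' v ≟ ρ' w)
    ≟-agree v w = does-⇔ (same-equalities v w) (ρ v ≟ ρ w) (ρ' v ≟ ρ' w)

realised-Entails : ∀ {n m} {G : Structure n m} {ψ : QF n m XY} →
  (∀ a b → a ≢ b → T (eval G ⟨ a , b ⟩ ψ)) →
  ∀ {a b} → a ≢ b → Entails (tp G a) (tp₂ G a b) (tp G b) ψ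
realised-Entails {ψ = ψ} holds {a} {b} a≢b G' a' b' a'≢b' tp-a tp-ab tp-b =
  subst T (eval-≡-by-types a≢b a'≢b' (sym tp-a) (sym tp-ab) (sym tp-b) ψ) (holds a b a≢b)

realised-InTwoTps : ∀ {n m} {φ : NormalForm n m} {G : Structure n m} → G ⊨ φ →
  ∀ {a b} → a ≢ b → InTwoTps φ (tp G a) (tp G b) (tp₂ G a b)
realised-InTwoTps {φ = φ} (_ , α-holds , _) a≢b =
  realised-Entails {ψ = α φ} α-holds a≢b , realised-Entails {ψ = α φ} α-holds (a≢b ∘ sym)

module _ {n m} (φ : NormalForm n m) (G : Structure n m) where

  counted-edge : Fin (m' φ) → Dom G → Dom G → Bool
  counted-edge i a b = Rᴳ G (cnt φ i) a b ∧ not (does (a ≟ b))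

  edges : Dom G → Dom G → ℕ
  edges a b = ∑[ i < m' φ ] 𝟙 (counted-edge i a b)

  ∑-edges≡Kφ : G ⊨ φ → ∀ a → ∑[ b < size G ] edges a b ≡ Kφ φ
  ∑-edges≡Kφ (_ , _ , counts) a = begin
      ∑[ b < size G ] ∑[ i < m' φ ] 𝟙 (counted-edge i a b)
    ≡⟨ ∑-comm (λ b i → 𝟙 (counted-edge i a b)) ⟩
      ∑[ i < m' φ ] ∑[ b < size G ] 𝟙 (counted-edge i a b)
    ≡⟨ sum-cong-≗ (λ i → trans (sym (countᴮ≡∑𝟙 (counted-edge i a))) (counts i a)) ⟩
      ∑[ i < m' φ ] k φ i
    ≡⟨ sumˡ-map-allFin (k φ) ⟨
      Kφ φ ∎
    where open ≡-Reasoning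

  edges≡0⇒ForwardSilent : ∀ {a b} → a ≢ b → edges a b ≡ 0 → ForwardSilent φ (tp₂ G a b)
  edges≡0⇒ForwardSilent {a} {b} a≢b no-edges i = begin
      lookup (proj₁ (tp₂ G a b)) (cnt φ i)
    ≡⟨ lookup∘tabulate _ (cnt φ i) ⟩
      Rᴳ G (cnt φ i) a b
    ≡⟨ ∧-identityʳ _ ⟨
      Rᴳ G (cnt φ i) a b ∧ true
    ≡⟨ cong (λ d → Rᴳ G (cnt φ i) a b ∧ not d) (dec-false (a ≟ b) a≢b) ⟨
      Rᴳ G (cnt φ i) a b ∧ not (does (a ≟ b))
    ≡⟨ 𝟙≡0⇒false (∑≡0⇒≡0 _ no-edges i) ⟩
      false ∎
    where open ≡-Reasoning

  -- Backward silence of (a , b) is, definitionally, forward silence of (b , a).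
  noisy⇒edge : G ⊨ φ → ∀ {a b} → a ≢ b → NoisyPair φ (tp G a) (tp G b) → 1 ≤ edges a b + edges b a
  noisy⇒edge sat {a} {b} a≢b noisy = n≢0⇒n>0 λ no-edges →
    noisy (tp₂ G a b , realised-InTwoTps {φ = φ} sat a≢b ,
           edges≡0⇒ForwardSilent a≢b (m+n≡0⇒m≡0 _ no-edges) ,
           edges≡0⇒ForwardSilent (a≢b ∘ sym) (m+n≡0⇒n≡0 _ no-edges))

lemma28 : ∀ {n m : ℕ} (φ : NormalForm n m) (G : Structure n m) → G ⊨ φ →
    ∀ (π₁ π₂ : OneType n m) → NoisyPair φ π₁ π₂ →
    (#realise G π₁ ≤ 2 * Kφ φ + 1) ⊎ (#realise G π₂ ≤ 2 * Kφ φ + 1)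
lemma28 φ G sat π₁ π₂ noisy =
  bounded-product⇒small-factor K _ _
    (subst₂ (λ p q → p * q ≤ K * p + K * q + p)
      (sym (countᴮ≡∑𝟙 realises₁)) (sym (countᴮ≡∑𝟙 realises₂))
      (covering-bound realises₁ realises₂ (edges φ G) (≤-reflexive ∘ ∑-edges≡Kφ φ G sat) covered))
  where
  K : ℕ
  K = Kφ φ

  realises₁ realises₂ : Dom G → Bool
  realises₁ a = does (tp G a ≟₁ π₁)
  realises₂ b = does (tp G b ≟₁ π₂)


  covered : ∀ a b → a ≢ b → T (realises₁ a) → T (realises₂ b) → 1 ≤ edges φ G a b + edges φ G b a
  covered a b a≢b a⊨π₁ b⊨π₂ =
    noisy⇒edge φ G sat a≢b
      (subst₂ (NoisyPair φ) (sym (T-does⇒ (tp G a ≟₁ π₁) a⊨π₁))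
                            (sym (T-does⇒ (tp G b ≟₁ π₂) b⊨π₂)) noisy)
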